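{- Let $\alpha \in \mathbb{C}$, let $\lambda = (\lambda_1,\ldots,\lambda_\ell) \in \mathbb{Z}_{>0}^\ell$, put $d = \lambda_1 + \cdots + \lambda_\ell$ and $s(j) = \lambda_1 + \cdots + \lambda_{j-1}$ for $j=1,\ldots,\ell$. Define coefficients $A_{\lambda,\alpha}(\mathbf{n})$, $\mathbf{n}=(n_1,\dots,n_d) \in \mathbb{Z}_{\ge 0}^d$, by the Taylor expansion \[ \left( \prod_{j=1}^{\ell}\Big[1 - \sum_{r=1}^{\lambda_j} x_{s(j)+r}\Big] - \alpha x_1 x_2 \cdots x_d \right)^{ -1} = \sum_{\mathbf{n} \in \mathbb{Z}_{\geq 0}^d} A_{\lambda,\alpha}(\mathbf{n})\, x_1^{n_1}\cdots x_d^{n_d}. \] Then for all $\mathbf{n} \in \mathbb{Z}_{\geq 0}^d$, \[ A_{\lambda,\alpha}(\mathbf{n}) = \sum_{k \in \mathbb{Z}} \alpha^k \prod_{j=1}^{\ell} \binom{n_{s(j)+1} + \cdots + n_{s(j)+\lambda_j} - (\lambda_j - 1)k}{n_{s(j)+1} - k, \ldots, n_{s(j)+\lambda_j} - k, k}. \]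
   Context: The multinomial coefficient $\binom{N}{a_1,\ldots,a_m}$ with $N = a_1+\cdots+a_m$ is $N!/(a_1!\cdots a_m!)$ when all $a_i\ge 0$ and is $0$ if some $a_i<0$ (for nonnegative $\mathbf{n}$ the sum therefore runs over $0 \le k \le \min(n_1,\ldots,n_d)$). -}

module Defs where

open import Function using (_∘_)
open import Algebra.Bundles using (CommutativeRing)
open import Data.Nat as ℕ using (ℕ; zero; suc; _∸_; _!; NonZero; _≡ᵇ_)
open import Data.Nat.Properties using (_!≢0; m*n≢0)
open import Data.Integer as ℤ using (ℤ; +_; -[1+_]; ∣_∣)
open import Data.List as L using (List; []; _∷_)
open import Data.Vec as V using (Vec; []; _∷_)
open import Data.Nat.ListAction using () renaming (sum to sumℕ)
open import Data.Bool using (Bool; true; false; if_then_else_; _∧_)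

-- Exponent vectors n = (n_1,…,n_d) ∈ ℤ_{≥0}^d  (stored 0-based)

Exp : ℕ → Set
Exp d = Vec ℕ d

box : ∀ {d} → Exp d → List (Exp d)
box []       = [] ∷ []
box (n ∷ ns) = L.concatMap (λ i → L.map (i ∷_) (box ns)) (L.upTo (suc n))

isZeroVec : ∀ {d} → Exp d → Bool
isZeroVec []       = true
isZeroVec (n ∷ ns) = (n ≡ᵇ 0) ∧ isZeroVec ns

isUnit : ∀ {d} → ℕ → Exp d → Bool
isUnit i       []       = false
isUnit zero    (n ∷ ns) = (n ≡ᵇ 1) ∧ isZeroVec ns
isUnit (suc i) (n ∷ ns) = (n ≡ᵇ 0) ∧ isUnit i ns

isAllOnes : ∀ {d} → Exp d → Bool
isAllOnes []       = true
isAllOnes (n ∷ ns) = (n ≡ᵇ 1) ∧ isAllOnes ns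

-- 0-based component (never used out of range)
nth : ∀ {d} → Exp d → ℕ → ℕ
nth []       _       = 0
nth (n ∷ ns) zero    = n
nth (n ∷ ns) (suc i) = nth ns i

minVec : ∀ {d} → Exp d → ℕ
minVec []           = 0
minVec (n ∷ [])     = n
minVec (n ∷ m ∷ ns) = n ℕ.⊓ minVec (m ∷ ns)

-- Multinomial coefficient with integer entries:
-- N!/(a_1!⋯a_m!) with N = a_1+⋯+a_m if all a_i ≥ 0, and 0 otherwise.

prodFact : List ℕ → ℕ
prodFact []       = 1
prodFact (a ∷ as) = a ! ℕ.* prodFact as

prodFact≢0 : ∀ as → NonZero (prodFact as)
prodFact≢0 []       = _
prodFact≢0 (a ∷ as) = m*n≢0 (a !) (prodFact as) {{a !≢0}} {{prodFact≢0 as}}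

multinomialℕ : List ℕ → ℕ
multinomialℕ as = ℕ._/_ (sumℕ as !) (prodFact as) {{prodFact≢0 as}}

allNonneg : List ℤ → Bool
allNonneg []            = true
allNonneg (+ _ ∷ as)    = allNonneg as
allNonneg (-[1+ _ ] ∷ as) = false

multinomial : List ℤ → ℕ
multinomial as = if allNonneg as then multinomialℕ (L.map ∣_∣ as) else 0

module Series {c ℓ} (R : CommutativeRing c ℓ) where
  open CommutativeRing R

  Ser : ℕ → Set c
  Ser d = Exp d → Carrier

  sumR : List Carrier → Carrier
  sumR = L.foldr _+_ 0#

  powR : Carrier → ℕ → Carrier
  powR a zero    = 1#
  powR a (suc k) = a * powR a k

  natR : ℕ → Carrier
  natR zero    = 0#
  natR (suc n) = 1# + natR n

  _⊛_ : ∀ {d} → Ser d → Ser d → Ser d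
  (f ⊛ g) n = sumR (L.map (λ m → f m * g (V.zipWith _∸_ n m)) (box n))

  _⊖_ : ∀ {d} → Ser d → Ser d → Ser d
  (f ⊖ g) n = f n - g n

  _⊕_ : ∀ {d} → Ser d → Ser d → Ser d
  (f ⊕ g) n = f n + g n

  zeroS : ∀ {d} → Ser d
  zeroS n = 0#

  oneS : ∀ {d} → Ser d
  oneS n = if isZeroVec n then 1# else 0#

  scale : ∀ {d} → Carrier → Ser d → Ser d
  scale a f n = a * f n

  -- the variable with 0-based index i (i.e. x_{i+1})
  var : ∀ {d} → ℕ → Ser d
  var i n = if isUnit i n then 1# else 0#

  monoAll : ∀ {d} → Ser d
  monoAll n = if isAllOnes n then 1# else 0#

  sumS : ∀ {d} → List (Ser d) → Ser d
  sumS = L.foldr _⊕_ zeroS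

  blockFactor : ∀ {d} → ℕ → ℕ → Ser d
  blockFactor o l = oneS ⊖ sumS (L.map (λ r → var (o ℕ.+ r)) (L.upTo l))

  -- ∏_j [1 - Σ_{r=1}^{λ_j} x_{s(j)+r}], with running offset o = s(j)
  blockProd : ∀ {d} → List ℕ → ℕ → Ser d
  blockProd []       o = oneS
  blockProd (l ∷ ls) o = blockFactor o l ⊛ blockProd ls (o ℕ.+ l)

  denom : (parts : List ℕ) → Carrier → Ser (sumℕ parts)
  denom parts α = blockProd parts 0 ⊖ scale α monoAll

  IsInverseOf : ∀ {d} → Ser d → Ser d → Set ℓ
  IsInverseOf A P = ∀ n → (P ⊛ A) n ≈ oneS n

  blockEntries : ∀ {d} → ℕ → ℕ → Exp d → ℕ → List ℤ
  blockEntries o l n k =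
    L.map (λ r → + nth n (o ℕ.+ r) ℤ.- + k) (L.upTo l) L.++ (+ k ∷ [])

  termProd : ∀ {d} → List ℕ → ℕ → Exp d → ℕ → Carrier
  termProd []       o n k = 1#
  termProd (l ∷ ls) o n k =
    natR (multinomial (blockEntries o l n k)) * termProd ls (o ℕ.+ l) n k

  rhs : ∀ {d} → List ℕ → Carrier → Exp d → Carrier
  rhs parts α n =
    sumR (L.map (λ k → powR α k * termProd parts 0 n k) (L.upTo (suc (minVec n))))

module Submission where

-- Since P has constant term 1, its inverse is unique (the coefficients are
-- forced by induction on the total degree: inverse-unique), so it suffices to
-- show P · F = 1 (F-inverse).  Multiplication by the j-th block factor is the
-- difference operator Δ_j G(n) = G(n) - Σ_r G(n - e_{s(j)+r}) (blockFactor-⊛)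
-- and multiplication by x₁⋯x_d is a shift by (1,…,1).  In the k-th term
-- α^k ∏_j M_j(·,k) the operator Δ_j only sees the factor M_j, and Pascal's
-- recurrence (blockMultinomial-recurrence) turns Δ_j M_j into the corner term
-- lowering the last entry k: [block = 0] if k = 0, M_j(n - 𝟙, k - 1) if k ≥ 1.
-- Summing over k gives Δ_1 ⋯ Δ_ℓ F = 1 + α x₁⋯x_d F (blockDiffs-F).

open import Defs
open import Algebra.Bundles using (CommutativeRing)
open import Data.Nat using (ℕ; _<_)
open import Data.List using (List; length)
open import Data.Nat.ListAction using (sum)
open import Data.List.Relation.Unary.All as All using (All)
open import Data.Nat as ℕ using (zero; suc; _∸_; _≤_; z≤n; s≤s; pred)
import Data.Nat.Properties as ℕP
open import Data.List as L using ([]; _∷_; _++_; map; upTo; concatMap)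
import Data.List.Properties as LP
open import Data.Vec as V using ([]; _∷_)
open import Data.Bool using (Bool; true; false; if_then_else_; _∧_)
open import Data.Sum using (_⊎_; inj₁; inj₂)
open import Data.Unit using (⊤; tt)
open import Data.Empty using (⊥-elim)
open import Relation.Binary.PropositionalEquality as ≡ using (_≡_; _≢_)
open import Function using (_∘_)
open import Level using (Level)

module Multinomials where

  open import Data.Nat using (_+_; _*_; _!)
  open import Data.Nat.Properties
  open import Data.Nat.Divisibility using (_∣_; *-monoʳ-∣; ∣-trans; ∣-refl)
  open import Data.Nat.DivMod using (m/n*n≡m)
  open import Data.Nat.Combinatorics using ([n∸k]!k!∣n!)
  open import Data.Nat.Tactic.RingSolver using (solve-∀)
  open import Data.Nat.ListAction.Properties using (sum-++)
  open import Data.Integer as ℤ using (ℤ; -[1+_]; ∣_∣; _⊖_)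
  import Data.Integer.Properties as ℤP
  open import Data.List.Properties using (map-id)
  open import Data.Bool.Properties using (∧-identityʳ; ∧-zeroʳ)
  open import Relation.Binary.PropositionalEquality using (refl; sym; trans; cong; cong₂; subst; module ≡-Reasoning)

  -- Boolean comparisons by structural recursion, so that they compute on
  -- symbolic arguments of the form suc a.

  atLeast : ℕ → ℕ → Bool
  atLeast zero    a       = true
  atLeast (suc k) zero    = false
  atLeast (suc k) (suc a) = atLeast k a

  positive : ℕ → Bool
  positive = atLeast 1

  allAtLeast : ℕ → List ℕ → Bool
  allAtLeast k []       = true
  allAtLeast k (a ∷ as) = atLeast k a ∧ allAtLeast k as

  allZero : List ℕ → Bool
  allZero []           = true
  allZero (zero  ∷ as) = allZero as
  allZero (suc _ ∷ as) = false

  atLeast⇒≤ : ∀ k a → atLeast k a ≡ true → k ≤ a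
  atLeast⇒≤ zero    a       _ = z≤n
  atLeast⇒≤ (suc k) (suc a) h = s≤s (atLeast⇒≤ k a h)

  ¬atLeast⇒> : ∀ k a → atLeast k a ≡ false → a < k
  ¬atLeast⇒> (suc k) zero    _ = s≤s z≤n
  ¬atLeast⇒> (suc k) (suc a) h = s≤s (¬atLeast⇒> k a h)

  allZero-++ : ∀ as bs → allZero (as ++ bs) ≡ allZero as ∧ allZero bs
  allZero-++ []           bs = refl
  allZero-++ (zero  ∷ as) bs = allZero-++ as bs
  allZero-++ (suc a ∷ as) bs = refl

  allAtLeast-++ : ∀ k as bs → allAtLeast k (as ++ bs) ≡ allAtLeast k as ∧ allAtLeast k bs
  allAtLeast-++ k []       bs = refl
  allAtLeast-++ k (a ∷ as) bs with atLeast k a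
  ... | true  = allAtLeast-++ k as bs
  ... | false = refl

  ∧-trueˡ : ∀ {a b} → a ∧ b ≡ true → a ≡ true
  ∧-trueˡ {true} _ = refl

  ∧-trueʳ : ∀ {a b} → a ∧ b ≡ true → b ≡ true
  ∧-trueʳ {true} h = h

  if-zero : ∀ b {v} → v ≡ 0 → (if b then v else 0) ≡ 0
  if-zero true  e = e
  if-zero false _ = refl

  prodFact∣sum! : ∀ as → prodFact as ∣ sum as !
  prodFact∣sum! []       = ∣-refl
  prodFact∣sum! (a ∷ as) = ∣-trans (*-monoʳ-∣ (a !) (prodFact∣sum! as)) a!b!∣[a+b]!
    where
    a!b!∣[a+b]! : a ! * sum as ! ∣ (a + sum as) !
    a!b!∣[a+b]! = subst (_∣ (a + sum as) !)
      (trans (cong (λ z → z ! * a !) (m+n∸m≡n a (sum as))) (*-comm (sum as !) (a !)))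
      ([n∸k]!k!∣n! (m≤m+n a (sum as)))

  multinomialℕ-spec : ∀ as → multinomialℕ as * prodFact as ≡ sum as !
  multinomialℕ-spec as = m/n*n≡m {{prodFact≢0 as}} (prodFact∣sum! as)

  multinomialℕ-unique : ∀ as x → x * prodFact as ≡ sum as ! → x ≡ multinomialℕ as
  multinomialℕ-unique as x eq =
    *-cancelʳ-≡ x (multinomialℕ as) (prodFact as) {{prodFact≢0 as}}
      (trans eq (sym (multinomialℕ-spec as)))

  -- Sum of f over the lower neighbours of a list:
  --   lowerSum f (a₁,…,aₘ) = Σ_{i : aᵢ > 0} f (a₁,…,aᵢ - 1,…,aₘ).

  lowerSum : (List ℕ → ℕ) → List ℕ → ℕ
  lowerSum f []       = 0
  lowerSum f (a ∷ as) =
    (if positive a then f (pred a ∷ as) else 0) + lowerSum (λ bs → f (a ∷ bs)) as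

  lowerSum-cong : ∀ as {f g : List ℕ → ℕ} → (∀ bs → f bs ≡ g bs) → lowerSum f as ≡ lowerSum g as
  lowerSum-cong []       h = refl
  lowerSum-cong (a ∷ as) h =
    cong₂ _+_ (cong (λ z → if positive a then z else 0) (h (pred a ∷ as)))
              (lowerSum-cong as (λ bs → h (a ∷ bs)))

  lowerSum-zero : ∀ as {f : List ℕ → ℕ} → (∀ bs → f bs ≡ 0) → lowerSum f as ≡ 0
  lowerSum-zero []       h = refl
  lowerSum-zero (a ∷ as) h = cong₂ _+_ (if-zero (positive a) (h _)) (lowerSum-zero as (λ bs → h (a ∷ bs)))

  lowerSum-++ : ∀ as bs (f : List ℕ → ℕ) →
                lowerSum f (as ++ bs) ≡ lowerSum (λ cs → f (cs ++ bs)) as + lowerSum (λ cs → f (as ++ cs)) bs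
  lowerSum-++ []       bs f = refl
  lowerSum-++ (a ∷ as) bs f =
    trans (cong (head +_) (lowerSum-++ as bs (λ cs → f (a ∷ cs)))) (sym (+-assoc head _ _))
    where head = if positive a then f (pred a ∷ as ++ bs) else 0

  -- The Pascal-type identity behind the multinomial recurrence, with an
  -- accumulated prefix: if f bs · ∏ bᵢ! · P = (s + Σ bᵢ)! for all bs, then
  -- lowerSum f as · ∏ aᵢ! · P = (s + Σ aᵢ - 1)! · Σ aᵢ, since each lower
  -- neighbour contributes aᵢ · (s + Σ aᵢ - 1)!.

  lowerSum-factorial : ∀ as (f : List ℕ → ℕ) s P → (∀ bs → f bs * prodFact bs * P ≡ (s + sum bs) !) →
                       lowerSum f as * prodFact as * P ≡ (s + sum as ∸ 1) ! * sum as
  lowerSum-factorial []           f s P H = sym (*-zeroʳ ((s + 0 ∸ 1) !))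
  lowerSum-factorial (zero ∷ as)  f s P H =
    trans (cong (λ z → lowerSum f′ as * z * P) (*-identityˡ (prodFact as)))
          (lowerSum-factorial as f′ s P H′)
    where
    f′ = λ bs → f (0 ∷ bs)
    H′ : ∀ bs → f′ bs * prodFact bs * P ≡ (s + sum bs) !
    H′ bs = trans (cong (λ z → f′ bs * z * P) (sym (*-identityˡ (prodFact bs)))) (H (0 ∷ bs))
  lowerSum-factorial (suc a ∷ as) f s P H = begin
    (A + B) * ((suc a * a !) * Q) * P                      ≡⟨ split A B (a !) a Q P ⟩
    suc a * (A * (a ! * Q) * P) + B * Q * (suc a ! * P)    ≡⟨ cong₂ (λ u v → suc a * u + v) (H (a ∷ as)) rest ⟩
    suc a * N ! + N ! * sum as                             ≡⟨ factor (suc a) (N !) (sum as) ⟩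
    N ! * (suc a + sum as)                                 ≡⟨ cong (λ z → (z ∸ 1) ! * (suc a + sum as)) (sym (+-suc s (a + sum as))) ⟩
    (s + (suc a + sum as) ∸ 1) ! * (suc a + sum as)        ∎
    where
    open ≡-Reasoning
    A = f (a ∷ as)
    f′ = λ bs → f (suc a ∷ bs)
    B = lowerSum f′ as
    Q = prodFact as
    N = s + (a + sum as)
    split : ∀ A B x y Q P → (A + B) * ((suc y * x) * Q) * P ≡ suc y * (A * (x * Q) * P) + B * Q * ((suc y * x) * P)
    split = solve-∀
    factor : ∀ x y z → x * y + y * z ≡ y * (x + z)
    factor = solve-∀
    H′ : ∀ bs → f′ bs * prodFact bs * (suc a ! * P) ≡ (s + suc a + sum bs) !
    H′ bs = trans (regroup (f′ bs) (prodFact bs) (suc a !) P)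
                  (trans (H (suc a ∷ bs)) (cong _! (sym (+-assoc s (suc a) (sum bs)))))
      where
      regroup : ∀ x y z w → x * y * (z * w) ≡ x * (z * y) * w
      regroup = solve-∀
    rest : B * Q * (suc a ! * P) ≡ N ! * sum as
    rest = trans (lowerSum-factorial as f′ (s + suc a) (suc a ! * P) H′)
                 (cong (λ z → (z ∸ 1) ! * sum as) (trans (+-assoc s (suc a) (sum as)) (+-suc s (a + sum as))))

  multinomialℕ-pascal : ∀ as → 1 ≤ sum as → multinomialℕ as ≡ lowerSum multinomialℕ as
  multinomialℕ-pascal as h = sym (multinomialℕ-unique as (lowerSum multinomialℕ as) (begin
    lowerSum multinomialℕ as * prodFact as      ≡⟨ sym (*-identityʳ _) ⟩
    lowerSum multinomialℕ as * prodFact as * 1  ≡⟨ lowerSum-factorial as multinomialℕ 0 1 spec ⟩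
    (sum as ∸ 1) ! * sum as                     ≡⟨ pred!* (sum as) h ⟩
    sum as !                                    ∎))
    where
    open ≡-Reasoning
    spec : ∀ bs → multinomialℕ bs * prodFact bs * 1 ≡ sum bs !
    spec bs = trans (*-identityʳ _) (multinomialℕ-spec bs)
    pred!* : ∀ n → 1 ≤ n → (n ∸ 1) ! * n ≡ n !
    pred!* (suc n) _ = *-comm (n !) (suc n)

  -- If as leaves the orthant, so do all its lower neighbours.
  lowerSum-outside : ∀ k as (f : List ℕ → ℕ) → allAtLeast k as ≡ false →
                     (∀ bs → allAtLeast k bs ≡ false → f bs ≡ 0) → lowerSum f as ≡ 0
  lowerSum-outside k (a ∷ as) f h hf with atLeast k a in e
  ... | false = cong₂ _+_ (if-zero (positive a) (hf _ (cong (_∧ _) (atLeast-pred k a e))))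
                          (lowerSum-zero as (λ bs → hf (a ∷ bs) (cong (_∧ allAtLeast k bs) e)))
    where
    atLeast-pred : ∀ k a → atLeast k a ≡ false → atLeast k (pred a) ≡ false
    atLeast-pred (suc k)       zero          _ = refl
    atLeast-pred (suc (suc k)) (suc zero)    _ = refl
    atLeast-pred (suc (suc k)) (suc (suc a)) e = atLeast-pred (suc k) (suc a) e
  ... | true = cong₂ _+_ (if-zero (positive a) (hf _ (trans (cong (atLeast k (pred a) ∧_) h) (∧-zeroʳ _))))
                         (lowerSum-outside k as (λ bs → f (a ∷ bs)) h
                            (λ bs h′ → hf (a ∷ bs) (trans (cong (_∧ allAtLeast k bs) e) h′)))

  -- Inside the orthant {bᵢ ≥ k+1}, translating by k+1 commutes with lowerSum:
  -- a lower neighbour that leaves the orthant contributes 0 on both sides.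
  lowerSum-translate : ∀ k as (f g : List ℕ → ℕ) → allAtLeast (suc k) as ≡ true →
                       (∀ bs → allAtLeast (suc k) bs ≡ true → f bs ≡ g (map (_∸ suc k) bs)) →
                       (∀ bs → allAtLeast (suc k) bs ≡ false → f bs ≡ 0) →
                       lowerSum f as ≡ lowerSum g (map (_∸ suc k) as)
  lowerSum-translate k []           f g h inside outside = refl
  lowerSum-translate k (suc a ∷ as) f g h inside outside =
    cong₂ _+_ head
      (lowerSum-translate k as (λ bs → f (suc a ∷ bs)) (λ bs → g (a ∸ k ∷ bs)) as-in
         (λ bs h′ → inside  (suc a ∷ bs) (trans (cong (_∧ allAtLeast (suc k) bs) a-in) h′))
         (λ bs h′ → outside (suc a ∷ bs) (trans (cong (_∧ allAtLeast (suc k) bs) a-in) h′)))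
    where
    a-in : atLeast k a ≡ true
    a-in = ∧-trueˡ {atLeast k a} h
    as-in : allAtLeast (suc k) as ≡ true
    as-in = ∧-trueʳ {atLeast k a} h
    head : f (a ∷ as) ≡ (if positive (a ∸ k) then g (pred (a ∸ k) ∷ map (_∸ suc k) as) else 0)
    head with atLeast (suc k) a in e
    ... | true = trans (inside (a ∷ as) (trans (cong (_∧ allAtLeast (suc k) as) e) as-in))
                       (trans (cong (λ z → g (z ∷ map (_∸ suc k) as)) (sym (pred[m∸n]≡m∸[1+n] a k)))
                              (sym (positive-if (a ∸ k) (m<n⇒0<n∸m (atLeast⇒≤ (suc k) a e)))))
      where
      positive-if : ∀ n {v} → 0 < n → (if positive n then v else 0) ≡ v
      positive-if (suc n) _ = refl
    ... | false = trans (outside (a ∷ as) (cong (_∧ allAtLeast (suc k) as) e))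
                        (sym (cong (λ z → if positive z then g (pred z ∷ map (_∸ suc k) as) else 0) a∸k≡0))
      where
      a∸k≡0 : a ∸ k ≡ 0
      a∸k≡0 = m≤n⇒m∸n≡0 (≤-pred (¬atLeast⇒> (suc k) a e))

  shiftedEntries : List ℕ → ℕ → List ℤ
  shiftedEntries as k = map (λ a → ℤ.+ a ℤ.- ℤ.+ k) as ++ (ℤ.+ k ∷ [])

  blockMultinomial : List ℕ → ℕ → ℕ
  blockMultinomial as k = multinomial (shiftedEntries as k)

  private
    ⊖-neg : ∀ a k → a < k → a ⊖ k ≡ -[1+ (k ∸ suc a) ]
    ⊖-neg zero    (suc k) _       = refl
    ⊖-neg (suc a) (suc k) (s≤s h) = trans (ℤP.[1+m]⊖[1+n]≡m⊖n a k) (⊖-neg a k h)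

    allNonneg-shifted : ∀ as k → allNonneg (shiftedEntries as k) ≡ allAtLeast k as
    allNonneg-shifted []       k = refl
    allNonneg-shifted (a ∷ as) k rewrite ℤP.m-n≡m⊖n a k with atLeast k a in e
    ... | true  rewrite ℤP.⊖-≥ (atLeast⇒≤ k a e) = allNonneg-shifted as k
    ... | false rewrite ⊖-neg a k (¬atLeast⇒> k a e) = refl

    abs-shifted : ∀ as k → allAtLeast k as ≡ true → map ∣_∣ (shiftedEntries as k) ≡ map (_∸ k) as ++ (k ∷ [])
    abs-shifted []       k h = refl
    abs-shifted (a ∷ as) k h with atLeast k a in e
    ... | true rewrite ℤP.m-n≡m⊖n a k | ℤP.⊖-≥ (atLeast⇒≤ k a e) = cong (a ∸ k ∷_) (abs-shifted as k h)

  blockMultinomial-inside : ∀ as k → allAtLeast k as ≡ true →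
                            blockMultinomial as k ≡ multinomialℕ (map (_∸ k) as ++ (k ∷ []))
  blockMultinomial-inside as k h rewrite allNonneg-shifted as k | h | abs-shifted as k h = refl

  blockMultinomial-outside : ∀ as k → allAtLeast k as ≡ false → blockMultinomial as k ≡ 0
  blockMultinomial-outside as k h rewrite allNonneg-shifted as k | h = refl

  -- The term of Pascal's recurrence for M(as, k) lowering the last entry k:
  -- M(as - (1,…,1), k - 1) if k ≥ 1, which degenerates to [as = 0] if k = 0.

  corner : List ℕ → ℕ → ℕ
  corner as zero    = if allZero as then 1 else 0
  corner as (suc k) = if allAtLeast 1 as then blockMultinomial (map pred as) k else 0

  private
    allAtLeast-zero : ∀ as → allAtLeast 0 as ≡ true
    allAtLeast-zero []       = refl
    allAtLeast-zero (a ∷ as) = allAtLeast-zero as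

    allZero-sum : ∀ as → allZero as ≡ true → sum as ≡ 0
    allZero-sum []          _ = refl
    allZero-sum (zero ∷ as) h = allZero-sum as h

    allZero-prodFact : ∀ as → allZero as ≡ true → prodFact as ≡ 1
    allZero-prodFact []          _ = refl
    allZero-prodFact (zero ∷ as) h = trans (+-identityʳ _) (allZero-prodFact as h)

    ¬allZero-sum : ∀ as → allZero as ≡ false → 1 ≤ sum as
    ¬allZero-sum (zero  ∷ as) h = ¬allZero-sum as h
    ¬allZero-sum (suc a ∷ as) _ = s≤s z≤n

    allZero-lowerSum : ∀ as f → allZero as ≡ true → lowerSum f as ≡ 0
    allZero-lowerSum []          f _ = refl
    allZero-lowerSum (zero ∷ as) f h = allZero-lowerSum as _ h

    allZero-multinomialℕ : ∀ as → allZero as ≡ true → multinomialℕ as ≡ 1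
    allZero-multinomialℕ as h = sym (multinomialℕ-unique as 1
      (trans (+-identityʳ _) (trans (allZero-prodFact as h) (cong _! (sym (allZero-sum as h))))))

    allAtLeast-one : ∀ k as → allAtLeast (suc k) as ≡ true → allAtLeast 1 as ≡ true
    allAtLeast-one k []           _ = refl
    allAtLeast-one k (suc a ∷ as) h = allAtLeast-one k as (∧-trueʳ {atLeast k a} h)

    allAtLeast-pred : ∀ k as → allAtLeast 1 as ≡ true → allAtLeast k (map pred as) ≡ allAtLeast (suc k) as
    allAtLeast-pred k []           _ = refl
    allAtLeast-pred k (suc a ∷ as) h = cong (atLeast k a ∧_) (allAtLeast-pred k as h)

    map-pred-∸ : ∀ k as → map (_∸ k) (map pred as) ≡ map (_∸ suc k) as
    map-pred-∸ k []       = refl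
    map-pred-∸ k (a ∷ as) = cong₂ _∷_ (pred-∸ a) (map-pred-∸ k as)
      where
      pred-∸ : ∀ a → pred a ∸ k ≡ a ∸ suc k
      pred-∸ zero    = 0∸n≡0 k
      pred-∸ (suc a) = refl

    blockMultinomial-at-0 : ∀ bs → blockMultinomial bs 0 ≡ multinomialℕ (bs ++ (0 ∷ []))
    blockMultinomial-at-0 bs =
      trans (blockMultinomial-inside bs 0 (allAtLeast-zero bs))
            (cong (λ z → multinomialℕ (z ++ (0 ∷ []))) (map-id bs))

  -- Pascal's recurrence for the block multinomial: lowering one of the first m
  -- entries of (a₁ - k, …, aₘ - k, k) is lowering the corresponding aᵢ, and
  -- lowering the last one gives the corner term.

  blockMultinomial-recurrence : ∀ as k →
    blockMultinomial as k ≡ corner as k + lowerSum (λ bs → blockMultinomial bs k) as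
  blockMultinomial-recurrence as zero with allZero as in e
  ... | true = begin
    blockMultinomial as 0                          ≡⟨ blockMultinomial-at-0 as ⟩
    multinomialℕ (as ++ (0 ∷ []))                  ≡⟨ allZero-multinomialℕ (as ++ (0 ∷ [])) (trans (allZero-++ as (0 ∷ [])) (trans (∧-identityʳ _) e)) ⟩
    1                                              ≡⟨ cong (1 +_) (sym (allZero-lowerSum as _ e)) ⟩
    1 + lowerSum (λ bs → blockMultinomial bs 0) as ∎
    where open ≡-Reasoning
  ... | false = begin
    blockMultinomial as 0                                     ≡⟨ blockMultinomial-at-0 as ⟩
    multinomialℕ (as ++ (0 ∷ []))                             ≡⟨ multinomialℕ-pascal (as ++ (0 ∷ [])) nonzero ⟩
    lowerSum multinomialℕ (as ++ (0 ∷ []))                    ≡⟨ lowerSum-++ as (0 ∷ []) multinomialℕ ⟩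
    lowerSum (λ bs → multinomialℕ (bs ++ (0 ∷ []))) as + 0    ≡⟨ +-identityʳ _ ⟩
    lowerSum (λ bs → multinomialℕ (bs ++ (0 ∷ []))) as        ≡⟨ lowerSum-cong as (λ bs → sym (blockMultinomial-at-0 bs)) ⟩
    lowerSum (λ bs → blockMultinomial bs 0) as                ∎
    where
    open ≡-Reasoning
    nonzero : 1 ≤ sum (as ++ (0 ∷ []))
    nonzero = subst (1 ≤_) (sym (sum-++ as (0 ∷ []))) (≤-trans (¬allZero-sum as e) (m≤m+n (sum as) 0))
  blockMultinomial-recurrence as (suc k) with allAtLeast (suc k) as in e
  ... | true rewrite allAtLeast-one k as e = begin
    blockMultinomial as (suc k)                                    ≡⟨ blockMultinomial-inside as (suc k) e ⟩
    multinomialℕ (bs ++ (suc k ∷ []))                              ≡⟨ multinomialℕ-pascal (bs ++ (suc k ∷ [])) nonzero ⟩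
    lowerSum multinomialℕ (bs ++ (suc k ∷ []))                     ≡⟨ lowerSum-++ bs (suc k ∷ []) multinomialℕ ⟩
    lowerSum (λ cs → multinomialℕ (cs ++ (suc k ∷ []))) bs + (multinomialℕ (bs ++ (k ∷ [])) + 0)
      ≡⟨ cong₂ _+_ (sym translated) (+-identityʳ _) ⟩
    lowerSum (λ cs → blockMultinomial cs (suc k)) as + multinomialℕ (bs ++ (k ∷ []))
      ≡⟨ +-comm (lowerSum (λ cs → blockMultinomial cs (suc k)) as) _ ⟩
    multinomialℕ (bs ++ (k ∷ [])) + lowerSum (λ cs → blockMultinomial cs (suc k)) as
      ≡⟨ cong (_+ lowerSum (λ cs → blockMultinomial cs (suc k)) as) (sym cornerEq) ⟩
    blockMultinomial (map pred as) k + lowerSum (λ cs → blockMultinomial cs (suc k)) as ∎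
    where
    open ≡-Reasoning
    bs = map (_∸ suc k) as
    nonzero : 1 ≤ sum (bs ++ (suc k ∷ []))
    nonzero = subst (1 ≤_) (sym (sum-++ bs (suc k ∷ []))) (≤-trans (s≤s z≤n) (m≤n+m (suc k + 0) (sum bs)))
    translated : lowerSum (λ cs → blockMultinomial cs (suc k)) as ≡ lowerSum (λ cs → multinomialℕ (cs ++ (suc k ∷ []))) bs
    translated = lowerSum-translate k as _ _ e (λ cs h → blockMultinomial-inside cs (suc k) h)
                                              (λ cs h → blockMultinomial-outside cs (suc k) h)
    cornerEq : blockMultinomial (map pred as) k ≡ multinomialℕ (bs ++ (k ∷ []))
    cornerEq = trans (blockMultinomial-inside (map pred as) k (trans (allAtLeast-pred k as (allAtLeast-one k as e)) e))
                     (cong (λ z → multinomialℕ (z ++ (k ∷ []))) (map-pred-∸ k as))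
  ... | false = trans (blockMultinomial-outside as (suc k) e)
                      (sym (cong₂ _+_ cornerZero (lowerSum-outside (suc k) as _ e (λ bs h → blockMultinomial-outside bs (suc k) h))))
    where
    cornerZero : corner as (suc k) ≡ 0
    cornerZero with allAtLeast 1 as in e₁
    ... | true  = blockMultinomial-outside (map pred as) k (trans (allAtLeast-pred k as e₁) e)
    ... | false = refl

module PowerSeries {c ℓ} (R : CommutativeRing c ℓ) where

  open Multinomials

  open CommutativeRing R hiding (zero)
  open Series R
  open import Algebra.Properties.Ring ring using (-0#≈0#; x[y-z]≈xy-xz; [y-z]x≈yx-zx)
  open import Algebra.Properties.AbelianGroup +-abelianGroup using (⁻¹-∙-comm; xyx⁻¹≈y; x∙y⁻¹≈ε⇒x≈y; x≈y⇒x∙y⁻¹≈ε)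
  open import Algebra.Properties.CommutativeSemigroup +-commutativeSemigroup using (interchange)
  open import Relation.Binary.Reasoning.Setoid setoid

  sub-cong : ∀ {a b c d} → a ≈ b → c ≈ d → a - c ≈ b - d
  sub-cong a≈b c≈d = +-cong a≈b (-‿cong c≈d)

  cancel-sub : ∀ {x y z} → x ≈ y + z → x - z ≈ y
  cancel-sub {x} {y} {z} h = trans (+-congʳ (trans h (+-comm y z))) (xyx⁻¹≈y z y)

  if-cong : ∀ b {x y} → x ≈ y → (if b then x else 0#) ≈ (if b then y else 0#)
  if-cong true  h = h
  if-cong false _ = refl

  if-true : ∀ {b x} → b ≡ true → (if b then x else 0#) ≈ x
  if-true ≡.refl = refl

  if-false : ∀ {b x} → b ≡ false → (if b then x else 0#) ≈ 0#
  if-false ≡.refl = refl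

  if-* : ∀ b x y → (if b then x else 0#) * y ≈ (if b then x * y else 0#)
  if-* true  x y = refl
  if-* false x y = zeroˡ y

  *-if : ∀ b x y → x * (if b then y else 0#) ≈ (if b then x * y else 0#)
  *-if true  x y = refl
  *-if false x y = zeroʳ x

  private variable
    a b : Level
    A : Set a
    B : Set b

  sumOver : List A → (A → Carrier) → Carrier
  sumOver xs f = sumR (map f xs)

  sumOver-cong : ∀ (xs : List A) {f g : A → Carrier} → (∀ x → f x ≈ g x) → sumOver xs f ≈ sumOver xs g
  sumOver-cong []       h = refl
  sumOver-cong (x ∷ xs) h = +-cong (h x) (sumOver-cong xs h)

  sumOver-zero : ∀ (xs : List A) {f : A → Carrier} → (∀ x → f x ≈ 0#) → sumOver xs f ≈ 0#
  sumOver-zero []       h = refl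
  sumOver-zero (x ∷ xs) h = trans (+-cong (h x) (sumOver-zero xs h)) (+-identityʳ 0#)

  sumOver-+ : ∀ (xs : List A) (f g : A → Carrier) →
              sumOver xs (λ x → f x + g x) ≈ sumOver xs f + sumOver xs g
  sumOver-+ []       f g = sym (+-identityʳ 0#)
  sumOver-+ (x ∷ xs) f g =
    trans (+-congˡ (sumOver-+ xs f g)) (interchange (f x) (g x) (sumOver xs f) (sumOver xs g))

  sumOver-*ˡ : ∀ (xs : List A) k (f : A → Carrier) → sumOver xs (λ x → k * f x) ≈ k * sumOver xs f
  sumOver-*ˡ []       k f = sym (zeroʳ k)
  sumOver-*ˡ (x ∷ xs) k f = trans (+-congˡ (sumOver-*ˡ xs k f)) (sym (distribˡ k (f x) _))

  sumOver-*ʳ : ∀ (xs : List A) k (f : A → Carrier) → sumOver xs (λ x → f x * k) ≈ sumOver xs f * k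
  sumOver-*ʳ xs k f =
    trans (sumOver-cong xs (λ x → *-comm (f x) k)) (trans (sumOver-*ˡ xs k f) (*-comm k _))

  sumOver-neg : ∀ (xs : List A) (f : A → Carrier) → sumOver xs (λ x → - f x) ≈ - sumOver xs f
  sumOver-neg []       f = sym -0#≈0#
  sumOver-neg (x ∷ xs) f = trans (+-congˡ (sumOver-neg xs f)) (⁻¹-∙-comm (f x) _)

  sumOver-sub : ∀ (xs : List A) (f g : A → Carrier) →
                sumOver xs (λ x → f x - g x) ≈ sumOver xs f - sumOver xs g
  sumOver-sub xs f g = trans (sumOver-+ xs f (λ x → - g x)) (+-congˡ (sumOver-neg xs g))

  sumOver-if : ∀ (xs : List A) b (f : A → Carrier) →
               sumOver xs (λ x → if b then f x else 0#) ≈ (if b then sumOver xs f else 0#)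
  sumOver-if xs true  f = refl
  sumOver-if xs false f = sumOver-zero xs (λ _ → refl)

  sumOver-++ : ∀ (xs ys : List A) (f : A → Carrier) → sumOver (xs ++ ys) f ≈ sumOver xs f + sumOver ys f
  sumOver-++ []       ys f = sym (+-identityˡ _)
  sumOver-++ (x ∷ xs) ys f = trans (+-congˡ (sumOver-++ xs ys f)) (sym (+-assoc (f x) _ _))

  sumOver-map : (xs : List B) (g : B → A) (f : A → Carrier) →
                sumOver (map g xs) f ≈ sumOver xs (f ∘ g)
  sumOver-map xs g f = reflexive (≡.cong sumR (≡.sym (LP.map-∘ xs)))

  sumOver-concatMap : (xs : List B) (g : B → List A) (f : A → Carrier) →
                      sumOver (concatMap g xs) f ≈ sumOver xs (λ x → sumOver (g x) f)
  sumOver-concatMap []       g f = refl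
  sumOver-concatMap (x ∷ xs) g f =
    trans (sumOver-++ (g x) (concatMap g xs) f) (+-congˡ (sumOver-concatMap xs g f))

  sumOver-swap : (xs : List A) (ys : List B) (f : A → B → Carrier) →
                 sumOver xs (λ x → sumOver ys (f x)) ≈ sumOver ys (λ y → sumOver xs (λ x → f x y))
  sumOver-swap []       ys f = sym (sumOver-zero ys (λ _ → refl))
  sumOver-swap (x ∷ xs) ys f =
    trans (+-congˡ (sumOver-swap xs ys f)) (sym (sumOver-+ ys (f x) (λ y → sumOver xs (λ x → f x y))))

  sumBelow : ℕ → (ℕ → Carrier) → Carrier
  sumBelow n f = sumOver (upTo n) f

  sumBelow-suc : ∀ n f → sumBelow (suc n) f ≈ f 0 + sumBelow n (f ∘ suc)
  sumBelow-suc n f = +-congˡ (reflexive (≡.cong sumR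
    (≡.trans (LP.map-applyUpTo suc f n) (≡.sym (LP.map-upTo (f ∘ suc) n)))))

  sumBelow-cong : ∀ n {f g} → (∀ i → i < n → f i ≈ g i) → sumBelow n f ≈ sumBelow n g
  sumBelow-cong zero    h = refl
  sumBelow-cong (suc n) {f} {g} h =
    trans (sumBelow-suc n f)
          (trans (+-cong (h 0 (s≤s z≤n)) (sumBelow-cong n (λ i i<n → h (suc i) (s≤s i<n))))
                 (sym (sumBelow-suc n g)))

  sumBelow-+ : ∀ a b f → sumBelow (a ℕ.+ b) f ≈ sumBelow a f + sumBelow b (λ i → f (a ℕ.+ i))
  sumBelow-+ zero    b f = sym (+-identityˡ _)
  sumBelow-+ (suc a) b f = begin
    sumBelow (suc a ℕ.+ b) f                                      ≈⟨ sumBelow-suc (a ℕ.+ b) f ⟩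
    f 0 + sumBelow (a ℕ.+ b) (f ∘ suc)                            ≈⟨ +-congˡ (sumBelow-+ a b (f ∘ suc)) ⟩
    f 0 + (sumBelow a (f ∘ suc) + sumBelow b (λ i → f (suc a ℕ.+ i))) ≈⟨ sym (+-assoc _ _ _) ⟩
    (f 0 + sumBelow a (f ∘ suc)) + sumBelow b (λ i → f (suc a ℕ.+ i)) ≈⟨ +-congʳ (sym (sumBelow-suc a f)) ⟩
    sumBelow (suc a) f + sumBelow b (λ i → f (suc a ℕ.+ i))       ∎

  sumBelow-only0 : ∀ x {f} → (∀ j → f (suc j) ≈ 0#) → sumBelow (suc x) f ≈ f 0
  sumBelow-only0 x {f} h =
    trans (sumBelow-suc x f) (trans (+-congˡ (sumOver-zero (upTo x) h)) (+-identityʳ _))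

  sumBelow-only1 : ∀ x {f} → f 0 ≈ 0# → (∀ j → f (suc (suc j)) ≈ 0#) → sumBelow (suc (suc x)) f ≈ f 1
  sumBelow-only1 x {f} h₀ h =
    trans (sumBelow-suc (suc x) f) (trans (+-congˡ (sumBelow-only0 x h)) (trans (+-congʳ h₀) (+-identityˡ _)))

  _∸v_ : ∀ {d} → Exp d → Exp d → Exp d
  n ∸v m = V.zipWith _∸_ n m

  lower : ∀ {d} → ℕ → Exp d → Exp d
  lower i       []       = []
  lower zero    (x ∷ xs) = pred x ∷ xs
  lower (suc i) (x ∷ xs) = x ∷ lower i xs

  allPositive : ∀ {d} → Exp d → Bool
  allPositive []       = true
  allPositive (x ∷ xs) = positive x ∧ allPositive xs

  lowerAll : ∀ {d} → Exp d → Exp d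
  lowerAll = V.map pred

  -- The coefficient of x_{i+1} · G at n.
  shift : ∀ {d} → ℕ → Ser d → Ser d
  shift i G n = if positive (nth n i) then G (lower i n) else 0#

  box-cons : ∀ {d} x (xs : Exp d) (F : Exp (suc d) → Carrier) →
             sumOver (box (x ∷ xs)) F ≈ sumBelow (suc x) (λ j → sumOver (box xs) (λ m → F (j ∷ m)))
  box-cons x xs F = trans (sumOver-concatMap (upTo (suc x)) (λ i → map (i ∷_) (box xs)) F)
                          (sumOver-cong (upTo (suc x)) (λ j → sumOver-map (box xs) (j ∷_) F))

  oneS-⊛ : ∀ {d} (n : Exp d) (G : Ser d) → (oneS ⊛ G) n ≈ G n
  oneS-⊛ []       G = trans (+-identityʳ _) (*-identityˡ _)
  oneS-⊛ (x ∷ xs) G =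
    trans (box-cons x xs _)
          (trans (sumBelow-only0 x (λ j → sumOver-zero (box xs) (λ m → zeroˡ _)))
                 (oneS-⊛ xs (λ v → G (x ∷ v))))

  var-⊛ : ∀ {d} i (n : Exp d) (G : Ser d) → (var i ⊛ G) n ≈ shift i G n
  var-⊛ i       []              G = trans (+-identityʳ _) (zeroˡ _)
  var-⊛ zero    (zero ∷ xs)     G =
    trans (box-cons 0 xs _) (trans (+-identityʳ _) (sumOver-zero (box xs) (λ m → zeroˡ _)))
  var-⊛ zero    (suc x ∷ xs)    G =
    trans (box-cons (suc x) xs _)
          (trans (sumBelow-only1 x (sumOver-zero (box xs) (λ m → zeroˡ _))
                                   (λ j → sumOver-zero (box xs) (λ m → zeroˡ _)))
                 (oneS-⊛ xs (λ v → G (x ∷ v))))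
  var-⊛ (suc i) (x ∷ xs)        G =
    trans (box-cons x xs _)
          (trans (sumBelow-only0 x (λ j → sumOver-zero (box xs) (λ m → zeroˡ _)))
                 (var-⊛ i xs (λ v → G (x ∷ v))))

  monoAll-⊛ : ∀ {d} (n : Exp d) (G : Ser d) →
              (monoAll ⊛ G) n ≈ (if allPositive n then G (lowerAll n) else 0#)
  monoAll-⊛ []           G = trans (+-identityʳ _) (*-identityˡ _)
  monoAll-⊛ (zero ∷ xs)  G =
    trans (box-cons 0 xs _) (trans (+-identityʳ _) (sumOver-zero (box xs) (λ m → zeroˡ _)))
  monoAll-⊛ (suc x ∷ xs) G =
    trans (box-cons (suc x) xs _)
          (trans (sumBelow-only1 x (sumOver-zero (box xs) (λ m → zeroˡ _))
                                   (λ j → sumOver-zero (box xs) (λ m → zeroˡ _)))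
                 (monoAll-⊛ xs (λ v → G (x ∷ v))))

  -- Reindexing: the terms of a box sum with mᵢ > 0, evaluated at m - eᵢ, form
  -- the box sum below n - eᵢ.  This is the coefficient identity behind
  -- (x_{i+1} H) · B = x_{i+1} (H · B).
  sumOver-box-lower : ∀ {d} i (n : Exp d) (H : Exp d → Exp d → Carrier) →
    sumOver (box n) (λ m → if positive (nth m i) then H (lower i m) (n ∸v m) else 0#) ≈
    (if positive (nth n i) then sumOver (box (lower i n)) (λ m → H m (lower i n ∸v m)) else 0#)
  sumOver-box-lower i       []       H = +-identityʳ 0#
  sumOver-box-lower zero    (x ∷ xs) H = begin
    sumOver (box (x ∷ xs)) _                                                   ≈⟨ box-cons x xs _ ⟩
    sumBelow (suc x) _                                                         ≈⟨ sumBelow-suc x _ ⟩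
    sumOver (box xs) (λ _ → 0#) + sumBelow x (λ j → sumOver (box xs) (λ m → H (j ∷ m) ((x ∸ suc j) ∷ (xs ∸v m))))
      ≈⟨ trans (+-congʳ (sumOver-zero (box xs) (λ _ → refl))) (+-identityˡ _) ⟩
    sumBelow x (λ j → sumOver (box xs) (λ m → H (j ∷ m) ((x ∸ suc j) ∷ (xs ∸v m)))) ≈⟨ regroup x ⟩
    _                                                                          ∎
    where
    regroup : ∀ x → sumBelow x (λ j → sumOver (box xs) (λ m → H (j ∷ m) ((x ∸ suc j) ∷ (xs ∸v m)))) ≈
                    (if positive x then sumOver (box (pred x ∷ xs)) (λ m → H m ((pred x ∷ xs) ∸v m)) else 0#)
    regroup zero    = refl
    regroup (suc x) = sym (box-cons x xs _)
  sumOver-box-lower (suc i) (x ∷ xs) H = begin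
    sumOver (box (x ∷ xs)) _ ≈⟨ box-cons x xs _ ⟩
    sumBelow (suc x) (λ j → sumOver (box xs) (λ m → if positive (nth m i) then H (j ∷ lower i m) ((x ∸ j) ∷ (xs ∸v m)) else 0#))
      ≈⟨ sumBelow-cong (suc x) (λ j _ → sumOver-box-lower i xs (λ a b → H (j ∷ a) ((x ∸ j) ∷ b))) ⟩
    sumBelow (suc x) (λ j → if positive (nth xs i) then sumOver (box (lower i xs)) (λ m → H (j ∷ m) ((x ∸ j) ∷ (lower i xs ∸v m))) else 0#)
      ≈⟨ sumOver-if (upTo (suc x)) (positive (nth xs i)) _ ⟩
    (if positive (nth xs i) then sumBelow (suc x) (λ j → sumOver (box (lower i xs)) (λ m → H (j ∷ m) ((x ∸ j) ∷ (lower i xs ∸v m)))) else 0#)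
      ≈⟨ if-cong (positive (nth xs i)) (sym (box-cons x (lower i xs) _)) ⟩
    _ ∎

  ⊛-congˡ : ∀ {d} {f f′ : Ser d} (G : Ser d) → (∀ m → f m ≈ f′ m) → ∀ n → (f ⊛ G) n ≈ (f′ ⊛ G) n
  ⊛-congˡ G h n = sumOver-cong (box n) (λ m → *-congʳ (h m))

  ⊛-⊖ : ∀ {d} (f g G : Ser d) n → ((f ⊖ g) ⊛ G) n ≈ (f ⊛ G) n - (g ⊛ G) n
  ⊛-⊖ f g G n = trans (sumOver-cong (box n) (λ m → [y-z]x≈yx-zx _ (f m) (g m))) (sumOver-sub (box n) _ _)

  ⊛-scale : ∀ {d} a (f G : Ser d) n → (scale a f ⊛ G) n ≈ a * (f ⊛ G) n
  ⊛-scale a f G n = trans (sumOver-cong (box n) (λ m → *-assoc a (f m) _)) (sumOver-*ˡ (box n) a _)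

  ⊛-sumS : ∀ {d} (fs : List (Ser d)) (G : Ser d) n → (sumS fs ⊛ G) n ≈ sumOver fs (λ f → (f ⊛ G) n)
  ⊛-sumS []       G n = sumOver-zero (box n) (λ m → zeroˡ _)
  ⊛-sumS (f ∷ fs) G n = trans (sumOver-cong (box n) (λ m → distribʳ _ (f m) _))
                              (trans (sumOver-+ (box n) _ _) (+-congˡ (⊛-sumS fs G n)))

  shift-⊛ : ∀ {d} i (H B : Ser d) n → (shift i H ⊛ B) n ≈ shift i (H ⊛ B) n
  shift-⊛ i H B n = trans (sumOver-cong (box n) (λ m → if-* (positive (nth m i)) _ _))
                          (sumOver-box-lower i n (λ a b → H a * B b))

  blockDiff : ∀ {d} → ℕ → ℕ → Ser d → Ser d
  blockDiff o l G n = G n - sumBelow l (λ r → shift (o ℕ.+ r) G n)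

  blockFactor-⊛ : ∀ {d} o l (G : Ser d) n → (blockFactor o l ⊛ G) n ≈ blockDiff o l G n
  blockFactor-⊛ o l G n = begin
    (blockFactor o l ⊛ G) n                                           ≈⟨ ⊛-⊖ oneS _ G n ⟩
    (oneS ⊛ G) n - (sumS (map (λ r → var (o ℕ.+ r)) (upTo l)) ⊛ G) n
      ≈⟨ sub-cong (oneS-⊛ n G) (⊛-sumS (map (λ r → var (o ℕ.+ r)) (upTo l)) G n) ⟩
    G n - sumOver (map (λ r → var (o ℕ.+ r)) (upTo l)) (λ f → (f ⊛ G) n)
      ≈⟨ sub-cong refl (sumOver-map (upTo l) _ _) ⟩
    G n - sumBelow l (λ r → (var (o ℕ.+ r) ⊛ G) n)
      ≈⟨ sub-cong refl (sumBelow-cong l (λ r _ → var-⊛ (o ℕ.+ r) n G)) ⟩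
    blockDiff o l G n                                                  ∎

  -- Congruence of blockDiff for functions agreeing on a set of exponents
  -- closed under lowering a coordinate (the operator only looks below n).

  LowerClosed : ∀ {p d} → (Exp d → Set p) → Set p
  LowerClosed P = ∀ i m → P m → P (lower i m)

  blockDiff-congOn : ∀ {p d} {P : Exp d → Set p} → LowerClosed P → ∀ o l {G G′ : Ser d} →
                     (∀ m → P m → G m ≈ G′ m) → ∀ n → P n → blockDiff o l G n ≈ blockDiff o l G′ n
  blockDiff-congOn closed o l h n pn =
    sub-cong (h n pn) (sumBelow-cong l (λ r _ → if-cong (positive (nth n (o ℕ.+ r))) (h _ (closed (o ℕ.+ r) n pn))))

  blockDiff-cong : ∀ {d} o l {G G′ : Ser d} → (∀ m → G m ≈ G′ m) → ∀ n → blockDiff o l G n ≈ blockDiff o l G′ n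
  blockDiff-cong o l h n = blockDiff-congOn {P = λ _ → ⊤} (λ _ _ _ → tt) o l (λ m _ → h m) n tt

  blockDiff-⊛ : ∀ {d} o l (H B : Ser d) n → (blockDiff o l H ⊛ B) n ≈ blockDiff o l (H ⊛ B) n
  blockDiff-⊛ o l H B n = begin
    sumOver (box n) (λ m → blockDiff o l H m * B (n ∸v m))
      ≈⟨ sumOver-cong (box n) (λ m → [y-z]x≈yx-zx _ (H m) _) ⟩
    sumOver (box n) (λ m → H m * B (n ∸v m) - sumBelow l (λ r → shift (o ℕ.+ r) H m) * B (n ∸v m))
      ≈⟨ sumOver-sub (box n) _ _ ⟩
    (H ⊛ B) n - sumOver (box n) (λ m → sumBelow l (λ r → shift (o ℕ.+ r) H m) * B (n ∸v m))
      ≈⟨ sub-cong refl (sumOver-cong (box n) (λ m → sym (sumOver-*ʳ (upTo l) _ _))) ⟩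
    (H ⊛ B) n - sumOver (box n) (λ m → sumBelow l (λ r → shift (o ℕ.+ r) H m * B (n ∸v m)))
      ≈⟨ sub-cong refl (sumOver-swap (box n) (upTo l) _) ⟩
    (H ⊛ B) n - sumBelow l (λ r → (shift (o ℕ.+ r) H ⊛ B) n)
      ≈⟨ sub-cong refl (sumBelow-cong l (λ r _ → shift-⊛ (o ℕ.+ r) H B n)) ⟩
    blockDiff o l (H ⊛ B) n ∎

  blockDiffs : ∀ {d} → List ℕ → ℕ → Ser d → Ser d
  blockDiffs []       o G = G
  blockDiffs (l ∷ ls) o G = blockDiff o l (blockDiffs ls (o ℕ.+ l) G)

  blockDiffs-congOn : ∀ {p d} {P : Exp d → Set p} → LowerClosed P → ∀ ls o {G G′ : Ser d} →
                      (∀ m → P m → G m ≈ G′ m) → ∀ n → P n → blockDiffs ls o G n ≈ blockDiffs ls o G′ n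
  blockDiffs-congOn closed []       o h n pn = h n pn
  blockDiffs-congOn closed (l ∷ ls) o h n pn =
    blockDiff-congOn closed o l (blockDiffs-congOn closed ls (o ℕ.+ l) h) n pn

  blockDiffs-cong : ∀ {d} ls o {G G′ : Ser d} → (∀ m → G m ≈ G′ m) → ∀ n → blockDiffs ls o G n ≈ blockDiffs ls o G′ n
  blockDiffs-cong ls o h n = blockDiffs-congOn {P = λ _ → ⊤} (λ _ _ _ → tt) ls o (λ m _ → h m) n tt

  blockProd-⊛ : ∀ {d} ls o (G : Ser d) n → (blockProd ls o ⊛ G) n ≈ blockDiffs ls o G n
  blockProd-⊛ []       o G n = oneS-⊛ n G
  blockProd-⊛ (l ∷ ls) o G n = begin
    ((blockFactor o l ⊛ blockProd ls (o ℕ.+ l)) ⊛ G) n ≈⟨ ⊛-congˡ G (blockFactor-⊛ o l _) n ⟩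
    (blockDiff o l (blockProd ls (o ℕ.+ l)) ⊛ G) n     ≈⟨ blockDiff-⊛ o l _ G n ⟩
    blockDiff o l (blockProd ls (o ℕ.+ l) ⊛ G) n       ≈⟨ blockDiff-cong o l (blockProd-⊛ ls (o ℕ.+ l) G) n ⟩
    blockDiffs (l ∷ ls) o G n                          ∎

  shift-linear : ∀ {d} i (ks : List A) (w : A → Carrier) (T : A → Ser d) n →
                 shift i (λ m → sumOver ks (λ k → w k * T k m)) n ≈ sumOver ks (λ k → w k * shift i (T k) n)
  shift-linear i ks w T n with positive (nth n i)
  ... | true  = refl
  ... | false = sym (sumOver-zero ks (λ k → zeroʳ (w k)))

  blockDiff-linear : ∀ {d} o l (ks : List A) (w : A → Carrier) (T : A → Ser d) n →
                     blockDiff o l (λ m → sumOver ks (λ k → w k * T k m)) n ≈ sumOver ks (λ k → w k * blockDiff o l (T k) n)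
  blockDiff-linear o l ks w T n = begin
    sumOver ks (λ k → w k * T k n) - sumBelow l (λ r → shift (o ℕ.+ r) (λ m → sumOver ks (λ k → w k * T k m)) n)
      ≈⟨ sub-cong refl (sumBelow-cong l (λ r _ → shift-linear (o ℕ.+ r) ks w T n)) ⟩
    sumOver ks (λ k → w k * T k n) - sumBelow l (λ r → sumOver ks (λ k → w k * shift (o ℕ.+ r) (T k) n))
      ≈⟨ sub-cong refl (sumOver-swap (upTo l) ks _) ⟩
    sumOver ks (λ k → w k * T k n) - sumOver ks (λ k → sumBelow l (λ r → w k * shift (o ℕ.+ r) (T k) n))
      ≈⟨ sub-cong refl (sumOver-cong ks (λ k → sumOver-*ˡ (upTo l) (w k) _)) ⟩
    sumOver ks (λ k → w k * T k n) - sumOver ks (λ k → w k * sumBelow l (λ r → shift (o ℕ.+ r) (T k) n))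
      ≈⟨ sym (sumOver-sub ks _ _) ⟩
    sumOver ks (λ k → w k * T k n - w k * sumBelow l (λ r → shift (o ℕ.+ r) (T k) n))
      ≈⟨ sumOver-cong ks (λ k → sym (x[y-z]≈xy-xz (w k) _ _)) ⟩
    sumOver ks (λ k → w k * blockDiff o l (T k) n) ∎

  blockDiffs-linear : ∀ {d} ls o (ks : List A) (w : A → Carrier) (T : A → Ser d) n →
                      blockDiffs ls o (λ m → sumOver ks (λ k → w k * T k m)) n ≈ sumOver ks (λ k → w k * blockDiffs ls o (T k) n)
  blockDiffs-linear []       o ks w T n = refl
  blockDiffs-linear (l ∷ ls) o ks w T n =
    trans (blockDiff-cong o l (blockDiffs-linear ls (o ℕ.+ l) ks w T) n)
          (blockDiff-linear o l ks w (λ k → blockDiffs ls (o ℕ.+ l) (T k)) n)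

  nth-lower-≢ : ∀ {d} i j (m : Exp d) → i ≢ j → nth (lower i m) j ≡ nth m j
  nth-lower-≢ i       j       []      _  = ≡.refl
  nth-lower-≢ zero    zero    (x ∷ m) ne = ⊥-elim (ne ≡.refl)
  nth-lower-≢ zero    (suc j) (x ∷ m) _  = ≡.refl
  nth-lower-≢ (suc i) zero    (x ∷ m) _  = ≡.refl
  nth-lower-≢ (suc i) (suc j) (x ∷ m) ne = nth-lower-≢ i j m (λ e → ne (≡.cong suc e))

  nth-lower-≡ : ∀ {d} i (m : Exp d) → nth (lower i m) i ≡ pred (nth m i)
  nth-lower-≡ i       []      = ≡.refl
  nth-lower-≡ zero    (x ∷ m) = ≡.refl
  nth-lower-≡ (suc i) (x ∷ m) = nth-lower-≡ i m

  lower-comm : ∀ {d} i j (m : Exp d) → lower i (lower j m) ≡ lower j (lower i m)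
  lower-comm i       j       []      = ≡.refl
  lower-comm zero    zero    (x ∷ m) = ≡.refl
  lower-comm zero    (suc j) (x ∷ m) = ≡.refl
  lower-comm (suc i) zero    (x ∷ m) = ≡.refl
  lower-comm (suc i) (suc j) (x ∷ m) = ≡.cong (x ∷_) (lower-comm i j m)

  Ignores : ∀ {d} → ℕ → Ser d → Set ℓ
  Ignores i G = ∀ m → G (lower i m) ≈ G m

  blockDiff-pullˡ : ∀ {d} o l (c g : Ser d) → (∀ r → r < l → Ignores (o ℕ.+ r) c) → ∀ n →
                    blockDiff o l (λ m → c m * g m) n ≈ c n * blockDiff o l g n
  blockDiff-pullˡ o l c g ignores n = begin
    c n * g n - sumBelow l (λ r → shift (o ℕ.+ r) (λ m → c m * g m) n)
      ≈⟨ sub-cong refl (sumBelow-cong l (λ r r<l → pull r (ignores r r<l))) ⟩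
    c n * g n - sumBelow l (λ r → c n * shift (o ℕ.+ r) g n) ≈⟨ sub-cong refl (sumOver-*ˡ (upTo l) (c n) _) ⟩
    c n * g n - c n * sumBelow l (λ r → shift (o ℕ.+ r) g n) ≈⟨ sym (x[y-z]≈xy-xz (c n) _ _) ⟩
    c n * blockDiff o l g n ∎
    where
    pull : ∀ r → Ignores (o ℕ.+ r) c → shift (o ℕ.+ r) (λ m → c m * g m) n ≈ c n * shift (o ℕ.+ r) g n
    pull r ign = trans (if-cong (positive (nth n (o ℕ.+ r))) (*-congʳ (ign n)))
                       (sym (*-if (positive (nth n (o ℕ.+ r))) (c n) _))

  blockDiff-pullʳ : ∀ {d} o l (c g : Ser d) → (∀ r → r < l → Ignores (o ℕ.+ r) g) → ∀ n →
                    blockDiff o l (λ m → c m * g m) n ≈ blockDiff o l c n * g n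
  blockDiff-pullʳ o l c g ignores n =
    trans (blockDiff-cong o l (λ m → *-comm (c m) (g m)) n)
          (trans (blockDiff-pullˡ o l g c ignores n) (*-comm (g n) _))

  blockDiffs-pullˡ : ∀ {d} ls o (c g : Ser d) → (∀ i → o ≤ i → Ignores i c) → ∀ n →
                     blockDiffs ls o (λ m → c m * g m) n ≈ c n * blockDiffs ls o g n
  blockDiffs-pullˡ []       o c g ignores n = refl
  blockDiffs-pullˡ (l ∷ ls) o c g ignores n =
    trans (blockDiff-cong o l (blockDiffs-pullˡ ls (o ℕ.+ l) c g (λ i h → ignores i (ℕP.≤-trans (ℕP.m≤m+n o l) h))) n)
          (blockDiff-pullˡ o l c (blockDiffs ls (o ℕ.+ l) g) (λ r _ → ignores (o ℕ.+ r) (ℕP.m≤m+n o r)) n)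

  blockDiff-ignores : ∀ {d} i o l (G : Ser d) → i < o → Ignores i G → Ignores i (blockDiff o l G)
  blockDiff-ignores i o l G i<o ign m = sub-cong (ign m) (sumBelow-cong l unchanged)
    where
    unchanged : ∀ r → r < l → shift (o ℕ.+ r) G (lower i m) ≈ shift (o ℕ.+ r) G m
    unchanged r _ rewrite nth-lower-≢ i (o ℕ.+ r) m (ℕP.<⇒≢ (ℕP.<-≤-trans i<o (ℕP.m≤m+n o r)))
                   | lower-comm (o ℕ.+ r) i m = if-cong (positive (nth m (o ℕ.+ r))) (ign _)

  blockDiffs-ignores : ∀ {d} i ls o (G : Ser d) → i < o → Ignores i G → Ignores i (blockDiffs ls o G)
  blockDiffs-ignores i []       o G i<o ign = ign
  blockDiffs-ignores i (l ∷ ls) o G i<o ign =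
    blockDiff-ignores i o l _ i<o (blockDiffs-ignores i ls (o ℕ.+ l) G (ℕP.<-≤-trans i<o (ℕP.m≤m+n o l)) ign)

  block : ∀ {d} → Exp d → ℕ → ℕ → List ℕ
  block n o zero    = []
  block n o (suc l) = nth n o ∷ block n (suc o) l

  map-block : ∀ {d} (n : Exp d) (h : ℕ → A) l o →
              map (λ r → h (nth n (o ℕ.+ r))) (upTo l) ≡ map h (block n o l)
  map-block n h zero    o = ≡.refl
  map-block n h (suc l) o = ≡.cong₂ _∷_ (≡.cong (λ z → h (nth n z)) (ℕP.+-identityʳ o))
    (≡.trans (LP.map-applyUpTo suc (λ r → h (nth n (o ℕ.+ r))) l)
    (≡.trans (≡.sym (LP.map-upTo (λ r → h (nth n (o ℕ.+ suc r))) l))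
    (≡.trans (LP.map-cong (λ r → ≡.cong (λ z → h (nth n z)) (ℕP.+-suc o r)) (upTo l))
             (map-block n h l (suc o)))))

  blockEntries-block : ∀ {d} o l (n : Exp d) k → blockEntries o l n k ≡ shiftedEntries (block n o l) k
  blockEntries-block o l n k = ≡.cong (_++ _) (map-block n _ l o)

  block-lower : ∀ {d} i (m : Exp d) o l → i < o ⊎ o ℕ.+ l ≤ i → block (lower i m) o l ≡ block m o l
  block-lower i m o zero    _       = ≡.refl
  block-lower i m o (suc l) outside =
    ≡.cong₂ _∷_ (nth-lower-≢ i o m (i≢o outside)) (block-lower i m (suc o) l (next outside))
    where
    i≢o : i < o ⊎ o ℕ.+ suc l ≤ i → i ≢ o
    i≢o (inj₁ i<o) = ℕP.<⇒≢ i<o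
    i≢o (inj₂ o+l<i) e = ℕP.<⇒≢ (ℕP.<-≤-trans (ℕP.m<m+n o (s≤s z≤n)) o+l<i) (≡.sym e)
    next : i < o ⊎ o ℕ.+ suc l ≤ i → i < suc o ⊎ suc o ℕ.+ l ≤ i
    next (inj₁ i<o)    = inj₁ (ℕP.m<n⇒m<1+n i<o)
    next (inj₂ o+l<i) = inj₂ (≡.subst (_≤ i) (ℕP.+-suc o l) o+l<i)

  natR-+ : ∀ a b → natR (a ℕ.+ b) ≈ natR a + natR b
  natR-+ zero    b = sym (+-identityˡ _)
  natR-+ (suc a) b = trans (+-congˡ (natR-+ a b)) (sym (+-assoc 1# _ _))

  natR-if : ∀ b x → natR (if b then x else 0) ≈ (if b then natR x else 0#)
  natR-if true  x = refl
  natR-if false x = refl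

  sumShifts-block : ∀ {d} l o (n : Exp d) (f : List ℕ → ℕ) →
    sumBelow l (λ r → shift (o ℕ.+ r) (λ m → natR (f (block m o l))) n) ≈ natR (lowerSum f (block n o l))
  sumShifts-block zero    o n f = refl
  sumShifts-block (suc l) o n f = begin
    sumBelow (suc l) _ ≈⟨ sumBelow-suc l _ ⟩
    first + sumBelow l (λ r → if positive (nth n (o ℕ.+ suc r)) then natR (f (block (lower (o ℕ.+ suc r) n) o (suc l))) else 0#)
      ≈⟨ +-cong (reflexive first≡) (sumBelow-cong l (λ r _ → reflexive (rest≡ r))) ⟩
    (if positive (nth n o) then natR (f (pred (nth n o) ∷ block n (suc o) l)) else 0#) +
    sumBelow l (λ r → shift (suc o ℕ.+ r) (λ m → natR (f (nth n o ∷ block m (suc o) l))) n)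
      ≈⟨ +-cong (sym (natR-if (positive (nth n o)) _)) (sumShifts-block l (suc o) n (λ ys → f (nth n o ∷ ys))) ⟩
    natR (if positive (nth n o) then f (pred (nth n o) ∷ block n (suc o) l) else 0) +
    natR (lowerSum (λ ys → f (nth n o ∷ ys)) (block n (suc o) l))
      ≈⟨ sym (natR-+ (if positive (nth n o) then f (pred (nth n o) ∷ block n (suc o) l) else 0) _) ⟩
    natR (lowerSum f (block n o (suc l))) ∎
    where
    first = if positive (nth n (o ℕ.+ 0)) then natR (f (block (lower (o ℕ.+ 0) n) o (suc l))) else 0#
    first≡ : first ≡ (if positive (nth n o) then natR (f (pred (nth n o) ∷ block n (suc o) l)) else 0#)
    first≡ rewrite ℕP.+-identityʳ o | nth-lower-≡ o n | block-lower o n (suc o) l (inj₁ (ℕP.n<1+n o)) = ≡.refl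
    rest≡ : ∀ r → (if positive (nth n (o ℕ.+ suc r)) then natR (f (block (lower (o ℕ.+ suc r) n) o (suc l))) else 0#) ≡
                  shift (suc o ℕ.+ r) (λ m → natR (f (nth n o ∷ block m (suc o) l))) n
    rest≡ r rewrite ℕP.+-suc o r
                  | nth-lower-≢ (suc o ℕ.+ r) o n (λ e → ℕP.<⇒≢ (s≤s (ℕP.m≤m+n o r)) (≡.sym e)) = ≡.refl

  blockCoeff : ∀ {d} → ℕ → ℕ → ℕ → Ser d
  blockCoeff o l k m = natR (blockMultinomial (block m o l) k)

  blockDiff-blockCoeff : ∀ {d} o l k (n : Exp d) → blockDiff o l (blockCoeff o l k) n ≈ natR (corner (block n o l) k)
  blockDiff-blockCoeff o l k n = cancel-sub (begin
    natR (blockMultinomial (block n o l) k)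
      ≈⟨ reflexive (≡.cong natR (blockMultinomial-recurrence (block n o l) k)) ⟩
    natR (corner (block n o l) k ℕ.+ lowerSum (λ bs → blockMultinomial bs k) (block n o l))
      ≈⟨ natR-+ (corner (block n o l) k) _ ⟩
    natR (corner (block n o l) k) + natR (lowerSum (λ bs → blockMultinomial bs k) (block n o l))
      ≈⟨ +-congˡ (sym (sumShifts-block l o n (λ bs → blockMultinomial bs k))) ⟩
    natR (corner (block n o l) k) + sumBelow l (λ r → shift (o ℕ.+ r) (blockCoeff o l k) n) ∎)

  -- ∏_j corner(block_j(n), k): the image of the k-th term of the sum.
  cornerProd : ∀ {d} → List ℕ → ℕ → Exp d → ℕ → Carrier
  cornerProd []       o n k = 1#
  cornerProd (l ∷ ls) o n k = natR (corner (block n o l) k) * cornerProd ls (o ℕ.+ l) n k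

  termProd-ignores : ∀ {d} i ls o k → i < o → Ignores {d} i (λ m → termProd ls o m k)
  termProd-ignores i []       o k i<o m = refl
  termProd-ignores i (l ∷ ls) o k i<o m =
    *-cong (reflexive (≡.cong (natR ∘ multinomial)
             (≡.trans (blockEntries-block o l (lower i m) k)
             (≡.trans (≡.cong (λ z → shiftedEntries z k) (block-lower i m o l (inj₁ i<o)))
                      (≡.sym (blockEntries-block o l m k))))))
           (termProd-ignores i ls (o ℕ.+ l) k (ℕP.<-≤-trans i<o (ℕP.m≤m+n o l)) m)

  blockCoeff-ignores : ∀ {d} o l k i → o ℕ.+ l ≤ i → Ignores {d} i (blockCoeff o l k)
  blockCoeff-ignores o l k i le m = reflexive (≡.cong (λ z → natR (blockMultinomial z k)) (block-lower i m o l (inj₂ le)))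

  blockDiffs-termProd : ∀ {d} ls o (n : Exp d) k → blockDiffs ls o (λ m → termProd ls o m k) n ≈ cornerProd ls o n k
  blockDiffs-termProd []       o n k = refl
  blockDiffs-termProd (l ∷ ls) o n k = begin
    blockDiffs (l ∷ ls) o (λ m → termProd (l ∷ ls) o m k) n
      ≈⟨ blockDiff-cong o l (blockDiffs-cong ls (o ℕ.+ l)
           (λ m → *-congʳ (reflexive (≡.cong (natR ∘ multinomial) (blockEntries-block o l m k))))) n ⟩
    blockDiff o l (blockDiffs ls (o ℕ.+ l) (λ m → blockCoeff o l k m * rest m)) n
      ≈⟨ blockDiff-cong o l (blockDiffs-pullˡ ls (o ℕ.+ l) (blockCoeff o l k) rest (blockCoeff-ignores o l k)) n ⟩
    blockDiff o l (λ m → blockCoeff o l k m * blockDiffs ls (o ℕ.+ l) rest m) n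
      ≈⟨ blockDiff-pullʳ o l (blockCoeff o l k) (blockDiffs ls (o ℕ.+ l) rest)
           (λ r r<l → blockDiffs-ignores (o ℕ.+ r) ls (o ℕ.+ l) rest (ℕP.+-monoʳ-< o r<l)
                        (termProd-ignores (o ℕ.+ r) ls (o ℕ.+ l) k (ℕP.+-monoʳ-< o r<l))) n ⟩
    blockDiff o l (blockCoeff o l k) n * blockDiffs ls (o ℕ.+ l) rest n
      ≈⟨ *-cong (blockDiff-blockCoeff o l k n) (blockDiffs-termProd ls (o ℕ.+ l) n k) ⟩
    cornerProd (l ∷ ls) o n k ∎
    where
    rest = λ m → termProd ls (o ℕ.+ l) m k

  -- The blocks of consecutive parts tile the
  -- coordinates, so the product of the k = 0 corners is [n = 0], and the
  -- product of the (k+1) corners is [n > 0] times the k-th term at n - (1,…,1).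

  block-++ : ∀ {d} (n : Exp d) o l L → block n o (l ℕ.+ L) ≡ block n o l ++ block n (o ℕ.+ l) L
  block-++ n o zero    L = ≡.cong (λ z → block n z L) (≡.sym (ℕP.+-identityʳ o))
  block-++ n o (suc l) L = ≡.cong (nth n o ∷_)
    (≡.trans (block-++ n (suc o) l L) (≡.cong (λ z → block n (suc o) l ++ block n z L) (≡.sym (ℕP.+-suc o l))))

  block-cons : ∀ {d} x (xs : Exp d) o L → block (x ∷ xs) (suc o) L ≡ block xs o L
  block-cons x xs o zero    = ≡.refl
  block-cons x xs o (suc L) = ≡.cong (nth xs o ∷_) (block-cons x xs (suc o) L)

  block-all : ∀ {d} (n : Exp d) → block n 0 d ≡ V.toList n
  block-all []       = ≡.refl
  block-all (x ∷ xs) = ≡.cong (x ∷_) (≡.trans (block-cons x xs 0 _) (block-all xs))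

  block-lowerAll : ∀ {d} (n : Exp d) o l → block (lowerAll n) o l ≡ map pred (block n o l)
  block-lowerAll n o zero    = ≡.refl
  block-lowerAll n o (suc l) = ≡.cong₂ _∷_ (nth-lowerAll n o) (block-lowerAll n (suc o) l)
    where
    nth-lowerAll : ∀ {d} (n : Exp d) i → nth (lowerAll n) i ≡ pred (nth n i)
    nth-lowerAll []      i       = ≡.refl
    nth-lowerAll (x ∷ n) zero    = ≡.refl
    nth-lowerAll (x ∷ n) (suc i) = nth-lowerAll n i

  isZeroVec-allZero : ∀ {d} (n : Exp d) → isZeroVec n ≡ allZero (V.toList n)
  isZeroVec-allZero []           = ≡.refl
  isZeroVec-allZero (zero  ∷ xs) = isZeroVec-allZero xs
  isZeroVec-allZero (suc x ∷ xs) = ≡.refl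

  allPositive-allAtLeast : ∀ {d} (n : Exp d) → allPositive n ≡ allAtLeast 1 (V.toList n)
  allPositive-allAtLeast []       = ≡.refl
  allPositive-allAtLeast (x ∷ xs) = ≡.cong (positive x ∧_) (allPositive-allAtLeast xs)

  cornerProd-zero : ∀ {d} ls o (n : Exp d) → cornerProd ls o n 0 ≈ (if allZero (block n o (sum ls)) then 1# else 0#)
  cornerProd-zero []       o n = refl
  cornerProd-zero (l ∷ ls) o n
    rewrite block-++ n o l (sum ls) | allZero-++ (block n o l) (block n (o ℕ.+ l) (sum ls))
    with allZero (block n o l)
  ... | true  = trans (*-congʳ (+-identityʳ 1#)) (trans (*-identityˡ _) (cornerProd-zero ls (o ℕ.+ l) n))
  ... | false = zeroˡ _

  cornerProd-suc : ∀ {d} ls o (n : Exp d) k →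
    cornerProd ls o n (suc k) ≈ (if allAtLeast 1 (block n o (sum ls)) then termProd ls o (lowerAll n) k else 0#)
  cornerProd-suc []       o n k = refl
  cornerProd-suc (l ∷ ls) o n k
    rewrite block-++ n o l (sum ls) | allAtLeast-++ 1 (block n o l) (block n (o ℕ.+ l) (sum ls))
    with allAtLeast 1 (block n o l)
  ... | true  = trans (*-congˡ (cornerProd-suc ls (o ℕ.+ l) n k))
                (trans (*-if (allAtLeast 1 (block n (o ℕ.+ l) (sum ls))) _ _)
                  (if-cong (allAtLeast 1 (block n (o ℕ.+ l) (sum ls)))
                    (*-congʳ (reflexive (≡.cong (natR ∘ multinomial)
                      (≡.sym (≡.trans (blockEntries-block o l (lowerAll n) k)
                                      (≡.cong (λ z → shiftedEntries z k) (block-lowerAll n o l)))))))))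
  ... | false = zeroˡ _

  termProd-outside : ∀ {d} ls o (m : Exp d) k → allAtLeast k (block m o (sum ls)) ≡ false → termProd ls o m k ≈ 0#
  termProd-outside (l ∷ ls) o m k h
    rewrite block-++ m o l (sum ls) | allAtLeast-++ k (block m o l) (block m (o ℕ.+ l) (sum ls))
    with allAtLeast k (block m o l) in e
  ... | true  = trans (*-congˡ (termProd-outside ls (o ℕ.+ l) m k h)) (zeroʳ _)
  ... | false = trans (*-congʳ (reflexive (≡.cong natR
                  (≡.trans (≡.cong multinomial (blockEntries-block o l m k)) (blockMultinomial-outside (block m o l) k e)))))
                (zeroˡ _)

  minVec-atLeast : ∀ {d} k (m : Exp d) → 1 ≤ d → allAtLeast k (V.toList m) ≡ true → k ≤ minVec m
  minVec-atLeast k (x ∷ [])     _ h = atLeast⇒≤ k x (∧-trueˡ {atLeast k x} h)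
  minVec-atLeast k (x ∷ y ∷ ys) _ h =
    ℕP.⊓-glb (atLeast⇒≤ k x (∧-trueˡ {atLeast k x} h)) (minVec-atLeast k (y ∷ ys) (s≤s z≤n) (∧-trueʳ {atLeast k x} h))

  minVec-lower : ∀ {d} i (m : Exp d) → minVec (lower i m) ≤ minVec m
  minVec-lower i             []           = ℕP.≤-refl
  minVec-lower zero          (x ∷ [])     = ℕP.pred[n]≤n
  minVec-lower (suc i)       (x ∷ [])     = ℕP.≤-refl
  minVec-lower zero          (x ∷ y ∷ ys) = ℕP.⊓-monoˡ-≤ (minVec (y ∷ ys)) ℕP.pred[n]≤n
  minVec-lower (suc zero)    (x ∷ y ∷ ys) = ℕP.⊓-monoʳ-≤ x (minVec-lower zero (y ∷ ys))
  minVec-lower (suc (suc i)) (x ∷ y ∷ ys) = ℕP.⊓-monoʳ-≤ x (minVec-lower (suc i) (y ∷ ys))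

  minVec-lowerAll : ∀ {d} (m : Exp d) → 1 ≤ d → allPositive m ≡ true → minVec m ≡ suc (minVec (lowerAll m))
  minVec-lowerAll (suc x ∷ [])     _ _ = ≡.refl
  minVec-lowerAll (suc x ∷ y ∷ ys) _ h rewrite minVec-lowerAll (y ∷ ys) (s≤s z≤n) h = ≡.refl

  -- The coefficient of P · A at n involves A only at
  -- exponents of total degree ≤ |n|, the one of degree |n| being P(0) A(n); so
  -- if P(0) = 1 the equations P · A = 1 determine A by induction on |n|.

  zeroExp : ∀ {d} → Exp d
  zeroExp {d} = V.replicate d 0

  degree-∸ : ∀ {d} (n m : Exp d) → V.sum (n ∸v m) ≤ V.sum n
  degree-∸ []       []       = ℕP.≤-refl
  degree-∸ (x ∷ xs) (j ∷ m) = ℕP.+-mono-≤ (ℕP.m∸n≤m x j) (degree-∸ xs m)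

  box-leading : ∀ {d} (n : Exp d) (G : Exp d → Exp d → Carrier) → (∀ m v → V.sum v < V.sum n → G m v ≈ 0#) →
                sumOver (box n) (λ m → G m (n ∸v m)) ≈ G zeroExp n
  box-leading []       G small = +-identityʳ _
  box-leading (x ∷ xs) G small = begin
    sumOver (box (x ∷ xs)) _ ≈⟨ box-cons x xs _ ⟩
    sumBelow (suc x) _       ≈⟨ sumBelow-suc x _ ⟩
    sumOver (box xs) (λ m → G (0 ∷ m) (x ∷ (xs ∸v m))) + sumBelow x (λ j → sumOver (box xs) (λ m → G (suc j ∷ m) ((x ∸ suc j) ∷ (xs ∸v m))))
      ≈⟨ +-cong (box-leading xs (λ m v → G (0 ∷ m) (x ∷ v)) (λ m v lt → small (0 ∷ m) (x ∷ v) (ℕP.+-monoʳ-< x lt)))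
                (lower-terms x small) ⟩
    G zeroExp (x ∷ xs) + 0#  ≈⟨ +-identityʳ _ ⟩
    G zeroExp (x ∷ xs)       ∎
    where
    lower-terms : ∀ x → (∀ m v → V.sum v < V.sum (x ∷ xs) → G m v ≈ 0#) →
                  sumBelow x (λ j → sumOver (box xs) (λ m → G (suc j ∷ m) ((x ∸ suc j) ∷ (xs ∸v m)))) ≈ 0#
    lower-terms zero    _     = refl
    lower-terms (suc x) small = sumOver-zero (upTo (suc x)) (λ j → sumOver-zero (box xs) (λ m →
                                  small _ _ (s≤s (ℕP.+-mono-≤ (ℕP.m∸n≤m x j) (degree-∸ xs m)))))

  inverse-unique : ∀ {d} (P A B : Ser d) → P zeroExp ≈ 1# → IsInverseOf A P → IsInverseOf B P → ∀ n → A n ≈ B n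
  inverse-unique P A B P₀≈1 A-inv B-inv n = agreeBelow (suc (V.sum n)) n (ℕP.n<1+n _)
    where
    agreeBelow : ∀ N n → V.sum n < N → A n ≈ B n
    agreeBelow (suc N) n |n|≤N = x∙y⁻¹≈ε⇒x≈y (A n) (B n) (begin
      A n - B n                                             ≈⟨ sym (*-identityˡ _) ⟩
      1# * (A n - B n)                                      ≈⟨ *-congʳ (sym P₀≈1) ⟩
      P zeroExp * (A n - B n)                               ≈⟨ sym (box-leading n (λ m v → P m * (A v - B v)) smaller) ⟩
      sumOver (box n) (λ m → P m * (A (n ∸v m) - B (n ∸v m))) ≈⟨ sumOver-cong (box n) (λ m → x[y-z]≈xy-xz (P m) _ _) ⟩
      sumOver (box n) (λ m → P m * A (n ∸v m) - P m * B (n ∸v m)) ≈⟨ sumOver-sub (box n) _ _ ⟩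
      (P ⊛ A) n - (P ⊛ B) n                                 ≈⟨ sub-cong (A-inv n) (B-inv n) ⟩
      oneS n - oneS n                                       ≈⟨ -‿inverseʳ _ ⟩
      0#                                                    ∎)
      where
      smaller : ∀ m v → V.sum v < V.sum n → P m * (A v - B v) ≈ 0#
      smaller m v lt = trans (*-congˡ (x≈y⇒x∙y⁻¹≈ε (agreeBelow N v (ℕP.<-≤-trans lt (ℕP.≤-pred |n|≤N))))) (zeroʳ _)

  blockProd-constant : ∀ {d} ls o → blockProd {d} ls o zeroExp ≈ 1#
  blockProd-constant {d} []       o = reflexive (≡.cong (λ b → if b then 1# else 0#) (isZeroVec-zero d))
    where
    isZeroVec-zero : ∀ d → isZeroVec (zeroExp {d}) ≡ true
    isZeroVec-zero zero    = ≡.refl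
    isZeroVec-zero (suc d) = isZeroVec-zero d
  blockProd-constant {d} (l ∷ ls) o = begin
    (blockFactor o l ⊛ blockProd ls (o ℕ.+ l)) (zeroExp {d}) ≈⟨ blockFactor-⊛ o l (blockProd ls (o ℕ.+ l)) zeroExp ⟩
    blockProd ls (o ℕ.+ l) (zeroExp {d}) - sumBelow l (λ r → shift (o ℕ.+ r) (blockProd ls (o ℕ.+ l)) (zeroExp {d}))
      ≈⟨ sub-cong (blockProd-constant {d} ls (o ℕ.+ l)) (sumOver-zero (upTo l) (λ r → if-false (positive-zero (o ℕ.+ r)))) ⟩
    1# - 0#                                             ≈⟨ cancel-sub (sym (+-identityʳ 1#)) ⟩
    1#                                                  ∎
    where
    nth-zero : ∀ d i → nth (zeroExp {d}) i ≡ 0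
    nth-zero zero    i       = ≡.refl
    nth-zero (suc d) zero    = ≡.refl
    nth-zero (suc d) (suc i) = nth-zero d i
    positive-zero : ∀ i → positive (nth (zeroExp {d}) i) ≡ false
    positive-zero i rewrite nth-zero d i = ≡.refl

  denom-constant : ∀ parts α → 1 ≤ sum parts → denom parts α zeroExp ≈ 1#
  denom-constant parts α nonempty =
    trans (sub-cong (blockProd-constant parts 0) (trans (*-congˡ (monoAll-zero nonempty)) (zeroʳ α)))
          (cancel-sub (sym (+-identityʳ 1#)))
    where
    monoAll-zero : ∀ {d} → 1 ≤ d → monoAll (zeroExp {d}) ≈ 0#
    monoAll-zero (s≤s _) = refl

  module Solution (α : Carrier) (parts : List ℕ) (nonempty : 1 ≤ sum parts) where

    F : Ser (sum parts)
    F = rhs parts α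

    term : ℕ → Ser (sum parts)
    term k m = termProd parts 0 m k

    rhs-extend : ∀ (m : Exp (sum parts)) K → minVec m ≤ K → sumBelow (suc K) (λ k → powR α k * term k m) ≈ F m
    rhs-extend m K M≤K = begin
      sumBelow (suc K) f                                    ≡⟨ ≡.cong (λ z → sumBelow (suc z) f) (≡.sym (ℕP.m+[n∸m]≡n M≤K)) ⟩
      sumBelow (suc M ℕ.+ (K ∸ M)) f                        ≈⟨ sumBelow-+ (suc M) (K ∸ M) f ⟩
      sumBelow (suc M) f + sumBelow (K ∸ M) (λ i → f (suc M ℕ.+ i)) ≈⟨ +-congˡ (sumOver-zero (upTo (K ∸ M)) beyond) ⟩
      sumBelow (suc M) f + 0#                               ≈⟨ +-identityʳ _ ⟩
      F m                                                   ∎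
      where
      M = minVec m
      f = λ k → powR α k * term k m
      outside : ∀ k → M < k → allAtLeast k (V.toList m) ≡ false
      outside k M<k with allAtLeast k (V.toList m) in e
      ... | true  = ⊥-elim (ℕP.<⇒≱ M<k (minVec-atLeast k m nonempty e))
      ... | false = ≡.refl
      beyond : ∀ i → f (suc M ℕ.+ i) ≈ 0#
      beyond i = trans (*-congˡ (termProd-outside parts 0 m (suc M ℕ.+ i)
                          (≡.trans (≡.cong (allAtLeast (suc M ℕ.+ i)) (block-all m))
                                   (outside (suc M ℕ.+ i) (s≤s (ℕP.m≤m+n M i))))))
                       (zeroʳ _)

    corners-zero : ∀ (n : Exp (sum parts)) → cornerProd parts 0 n 0 ≈ oneS n
    corners-zero n = trans (cornerProd-zero parts 0 n)
      (reflexive (≡.cong (λ b → if b then 1# else 0#) (≡.trans (≡.cong allZero (block-all n)) (≡.sym (isZeroVec-allZero n)))))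

    corners-suc : ∀ (n : Exp (sum parts)) → sumBelow (minVec n) (λ k → powR α (suc k) * cornerProd parts 0 n (suc k)) ≈
                        (if allPositive n then α * F (lowerAll n) else 0#)
    corners-suc n with allPositive n in pos
    ... | false = sumOver-zero (upTo (minVec n)) (λ k →
                    trans (*-congˡ (trans (cornerProd-suc parts 0 n k) (if-false test)))
                          (zeroʳ _))
      where
      test : allAtLeast 1 (block n 0 (sum parts)) ≡ false
      test = ≡.trans (≡.cong (allAtLeast 1) (block-all n)) (≡.trans (≡.sym (allPositive-allAtLeast n)) pos)
    ... | true = begin
      sumBelow (minVec n) (λ k → (α * powR α k) * cornerProd parts 0 n (suc k))
        ≈⟨ sumBelow-cong (minVec n) (λ k _ → *-congˡ (trans (cornerProd-suc parts 0 n k) (if-true test))) ⟩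
      sumBelow (minVec n) (λ k → (α * powR α k) * term k (lowerAll n))
        ≈⟨ trans (sumBelow-cong (minVec n) (λ k _ → *-assoc α _ _)) (sumOver-*ˡ (upTo (minVec n)) α _) ⟩
      α * sumBelow (minVec n) (λ k → powR α k * term k (lowerAll n))
        ≡⟨ ≡.cong (λ z → α * sumBelow z (λ k → powR α k * term k (lowerAll n))) (minVec-lowerAll n nonempty pos) ⟩
      α * F (lowerAll n) ∎
      where
      test : allAtLeast 1 (block n 0 (sum parts)) ≡ true
      test = ≡.trans (≡.cong (allAtLeast 1) (block-all n)) (≡.trans (≡.sym (allPositive-allAtLeast n)) pos)

    blockDiffs-F : ∀ (n : Exp (sum parts)) → blockDiffs parts 0 F n ≈ oneS n + (if allPositive n then α * F (lowerAll n) else 0#)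
    blockDiffs-F n = begin
      blockDiffs parts 0 F n
        ≈⟨ blockDiffs-congOn {P = λ m → minVec m ≤ K} (λ i m m≤K → ℕP.≤-trans (minVec-lower i m) m≤K) parts 0
             (λ m m≤K → sym (rhs-extend m K m≤K)) n ℕP.≤-refl ⟩
      blockDiffs parts 0 (λ m → sumBelow (suc K) (λ k → powR α k * term k m)) n
        ≈⟨ blockDiffs-linear parts 0 (upTo (suc K)) (powR α) term n ⟩
      sumBelow (suc K) (λ k → powR α k * blockDiffs parts 0 (term k) n)
        ≈⟨ sumBelow-cong (suc K) (λ k _ → *-congˡ (blockDiffs-termProd parts 0 n k)) ⟩
      sumBelow (suc K) (λ k → powR α k * cornerProd parts 0 n k)
        ≈⟨ sumBelow-suc K _ ⟩
      1# * cornerProd parts 0 n 0 + sumBelow K (λ k → powR α (suc k) * cornerProd parts 0 n (suc k))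
        ≈⟨ +-cong (trans (*-identityˡ _) (corners-zero n)) (corners-suc n) ⟩
      oneS n + (if allPositive n then α * F (lowerAll n) else 0#) ∎
      where K = minVec n

    F-inverse : IsInverseOf F (denom parts α)
    F-inverse n = begin
      (denom parts α ⊛ F) n                                 ≈⟨ ⊛-⊖ (blockProd parts 0) (scale α monoAll) F n ⟩
      (blockProd parts 0 ⊛ F) n - (scale α monoAll ⊛ F) n
        ≈⟨ sub-cong (blockProd-⊛ parts 0 F n) (trans (⊛-scale α monoAll F n) (*-congˡ (monoAll-⊛ n F))) ⟩
      blockDiffs parts 0 F n - α * (if allPositive n then F (lowerAll n) else 0#)
        ≈⟨ sub-cong (blockDiffs-F n) (*-if (allPositive n) α _) ⟩
      (oneS n + (if allPositive n then α * F (lowerAll n) else 0#)) - (if allPositive n then α * F (lowerAll n) else 0#)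
        ≈⟨ cancel-sub refl ⟩
      oneS n                                                ∎

sum-positive : ∀ parts → 0 < length parts → All (0 <_) parts → 1 ≤ sum parts
sum-positive (l ∷ ls) _ (0<l All.∷ _) = ℕP.≤-trans 0<l (ℕP.m≤m+n l (sum ls))

theorem3p1 : ∀ {c ℓ} (R : CommutativeRing c ℓ) (α : CommutativeRing.Carrier R)
               (parts : List ℕ) → 0 < length parts → All (0 <_) parts →
               (A : Series.Ser R (sum parts)) →
               Series.IsInverseOf R A (Series.denom R parts α) →
               (n : Exp (sum parts)) →
               CommutativeRing._≈_ R (A n) (Series.rhs R parts α n)
theorem3p1 R α parts nonempty positive-parts A A-inverse =
  inverse-unique (denom parts α) A F (denom-constant parts α d≥1) A-inverse F-inverse
  where
  open Series R using (denom)
  open PowerSeries R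
  d≥1 : 1 ≤ sum parts
  d≥1 = sum-positive parts nonempty positive-parts
  open Solution α parts d≥1
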